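{- In the logics $\mathbf{Cbr}$ and $\mathbf{Cie}$ the following hold (writing $\alpha\equiv\beta$ for $\vdash\alpha\leftrightarrow\beta$ in the respective logic): (i) $\circ\alpha\equiv\circ\neg\alpha$ for every formula $\alpha$; (ii) for all formulas $\alpha,\beta$: if $\alpha\equiv\beta$ and $\neg\alpha\equiv\neg\beta$, then $\circ\alpha\equiv\circ\beta$.
   Context: Formulas are built from a denumerable set of propositional variables using the binary connectives $\wedge,\vee,\rightarrow$ and the unary connectives $\neg$ (paraconsistent negation) and $\circ$ (consistency operator); $\alpha\leftrightarrow\beta$ abbreviates $(\alpha\rightarrow\beta)\wedge(\beta\rightarrow\alpha)$. The logic $\mathbf{Cbr}$ is the Hilbert calculus whose only inference rule is modus ponens (from $\alpha$ and $\alpha\rightarrow\beta$ infer $\beta$) and whose axiom schemas are: (1) $\alpha\rightarrow(\beta\rightarrow\alpha)$; (2) $(\alpha\rightarrow(\beta\rightarrow\gamma))\rightarrow((\alpha\rightarrow\beta)\rightarrow(\alpha\rightarrow\gamma))$; (3) $\alpha\rightarrow(\beta\rightarrow(\alpha\wedge\beta))$; (4) $(\alpha\wedge\beta)\rightarrow\alpha$; (5) $(\alpha\wedge\beta)\rightarrow\beta$; (6) $\alpha\rightarrow(\alpha\vee\beta)$; (7) $\beta\rightarrow(\alpha\vee\beta)$; (8) $(\alpha\rightarrow\gamma)\rightarrow((\beta\rightarrow\gamma)\rightarrow((\alpha\vee\beta)\rightarrow\gamma))$; (9) $(\alpha\rightarrow\beta)\vee\alpha$; (10) $\alpha\vee\neg\alpha$;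 (11) $\circ\alpha\rightarrow(\alpha\rightarrow(\neg\alpha\rightarrow\beta))$; (12) $\circ\alpha\vee(\alpha\wedge\neg\alpha)$; (13) $\alpha\rightarrow\neg\neg\alpha$; (14) $\neg\neg\alpha\rightarrow\alpha$. The logic $\mathbf{Cie}$ is obtained from $\mathbf{Cbr}$ by replacing axiom schema (12) with $\neg\circ\alpha\rightarrow(\alpha\wedge\neg\alpha)$. Derivations are the usual Hilbert-style ones. -}

module Defs where

open import Data.Nat using (ℕ)
open import Data.Product using (_×_)

data Formula : Set where
  var  : ℕ → Formula
  _∧'_ : Formula → Formula → Formula
  _∨'_ : Formula → Formula → Formula
  _⇒_  : Formula → Formula → Formula
  ¬'_  : Formula → Formula
  ∘_   : Formula → Formula

infixr 5 _⇒_
infixr 6 _∨'_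
infixr 7 _∧'_
infix 8 ¬'_ ∘_

_⇔'_ : Formula → Formula → Formula
α ⇔' β = (α ⇒ β) ∧' (β ⇒ α)

data Logic : Set where
  Cbr Cie : Logic

data Axiom : Logic → Formula → Set where
  ax1  : ∀ {L} α β → Axiom L (α ⇒ (β ⇒ α))
  ax2  : ∀ {L} α β γ → Axiom L ((α ⇒ (β ⇒ γ)) ⇒ ((α ⇒ β) ⇒ (α ⇒ γ)))
  ax3  : ∀ {L} α β → Axiom L (α ⇒ (β ⇒ (α ∧' β)))
  ax4  : ∀ {L} α β → Axiom L ((α ∧' β) ⇒ α)
  ax5  : ∀ {L} α β → Axiom L ((α ∧' β) ⇒ β)
  ax6  : ∀ {L} α β → Axiom L (α ⇒ (α ∨' β))
  ax7  : ∀ {L} α β → Axiom L (β ⇒ (α ∨' β))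
  ax8  : ∀ {L} α β γ → Axiom L ((α ⇒ γ) ⇒ ((β ⇒ γ) ⇒ ((α ∨' β) ⇒ γ)))
  ax9  : ∀ {L} α β → Axiom L ((α ⇒ β) ∨' α)
  ax10 : ∀ {L} α → Axiom L (α ∨' ¬' α)
  ax11 : ∀ {L} α β → Axiom L (∘ α ⇒ (α ⇒ (¬' α ⇒ β)))
  ax12-Cbr : ∀ α → Axiom Cbr (∘ α ∨' (α ∧' ¬' α))
  ax12-Cie : ∀ α → Axiom Cie (¬' (∘ α) ⇒ (α ∧' ¬' α))
  ax13 : ∀ {L} α → Axiom L (α ⇒ ¬' ¬' α)
  ax14 : ∀ {L} α → Axiom L (¬' ¬' α ⇒ α)

data ⊢[_]_ (L : Logic) : Formula → Set where
  axiom : ∀ {φ} → Axiom L φ → ⊢[ L ] φ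
  mp    : ∀ {φ ψ} → ⊢[ L ] φ → ⊢[ L ] (φ ⇒ ψ) → ⊢[ L ] ψ

infix 2 ⊢[_]_

_≡[_]_ : Formula → Logic → Formula → Set
α ≡[ L ] β = ⊢[ L ] (α ⇔' β)

infix 3 _≡[_]_

{-# OPTIONS --safe #-}
-- In both logics ∘ α ∨ (α ∧ ¬ α) is a theorem (an axiom of Cbr; in Cie it follows from
-- excluded middle for ∘ α and ¬ ∘ α → α ∧ ¬ α), while ∘ α explodes against α ∧ ¬ α.
-- Hence ∘ α → ∘ β as soon as β ∧ ¬ β → α ∧ ¬ α, so ∘ α is determined up to equivalence
-- by α ∧ ¬ α. Both claims then reduce to equivalences between such conjunctions:
-- α ∧ ¬ α ≡ ¬ α ∧ ¬ ¬ α by double negation, and α ∧ ¬ α ≡ β ∧ ¬ β by the hypotheses.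
module Submission where

open import Data.List using (List; []; _∷_)
open import Data.List.Membership.Propositional using (_∈_)
open import Data.List.Relation.Unary.Any using (here; there)
open import Data.Product using (_×_; _,_)
open import Relation.Binary.PropositionalEquality using (refl)

open import Defs

inconsistent : Formula → Formula
inconsistent α = α ∧' ¬' α

module Derivation (L : Logic) where

  infix 2 _⊢_

  data _⊢_ (Γ : List Formula) : Formula → Set where
    hyp    : ∀ {φ} → φ ∈ Γ → Γ ⊢ φ
    ax     : ∀ {φ} → Axiom L φ → Γ ⊢ φ
    ⇒-elim : ∀ {φ ψ} → Γ ⊢ φ ⇒ ψ → Γ ⊢ φ → Γ ⊢ ψ

  theorem : ∀ {Γ φ} → ⊢[ L ] φ → Γ ⊢ φ
  theorem (axiom a) = ax a
  theorem (mp d e)  = ⇒-elim (theorem e) (theorem d)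

  closed : ∀ {φ} → [] ⊢ φ → ⊢[ L ] φ
  closed (hyp ())
  closed (ax a)       = axiom a
  closed (⇒-elim d e) = mp (closed e) (closed d)

  var₀ : ∀ {Γ φ} → φ ∷ Γ ⊢ φ
  var₀ = hyp (here refl)

  var₁ : ∀ {Γ φ ψ} → ψ ∷ φ ∷ Γ ⊢ φ
  var₁ = hyp (there (here refl))

  ⇒-refl : ∀ {Γ} φ → Γ ⊢ φ ⇒ φ
  ⇒-refl φ = ⇒-elim (⇒-elim (ax (ax2 φ (φ ⇒ φ) φ)) (ax (ax1 φ (φ ⇒ φ)))) (ax (ax1 φ φ))

  ⇒-intro : ∀ {Γ φ ψ} → φ ∷ Γ ⊢ ψ → Γ ⊢ φ ⇒ ψ
  ⇒-intro {φ = φ} (hyp (here refl))       = ⇒-refl φ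
  ⇒-intro {φ = φ} (hyp (there p))         = ⇒-elim (ax (ax1 _ φ)) (hyp p)
  ⇒-intro {φ = φ} (ax a)                  = ⇒-elim (ax (ax1 _ φ)) (ax a)
  ⇒-intro {φ = φ} {ψ} (⇒-elim {χ} d e) =
    ⇒-elim (⇒-elim (ax (ax2 φ χ ψ)) (⇒-intro d)) (⇒-intro e)

  ∧-intro : ∀ {Γ α β} → Γ ⊢ α → Γ ⊢ β → Γ ⊢ α ∧' β
  ∧-intro {α = α} {β} d e = ⇒-elim (⇒-elim (ax (ax3 α β)) d) e

  ∧-elimˡ : ∀ {Γ α β} → Γ ⊢ α ∧' β → Γ ⊢ α
  ∧-elimˡ {α = α} {β} d = ⇒-elim (ax (ax4 α β)) d

  ∧-elimʳ : ∀ {Γ α β} → Γ ⊢ α ∧' β → Γ ⊢ β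
  ∧-elimʳ {α = α} {β} d = ⇒-elim (ax (ax5 α β)) d

  ∨-introˡ : ∀ {Γ α β} → Γ ⊢ α → Γ ⊢ α ∨' β
  ∨-introˡ {α = α} {β} d = ⇒-elim (ax (ax6 α β)) d

  ∨-introʳ : ∀ {Γ α β} → Γ ⊢ β → Γ ⊢ α ∨' β
  ∨-introʳ {α = α} {β} d = ⇒-elim (ax (ax7 α β)) d

  ∨-elim : ∀ {Γ α β γ} → Γ ⊢ α ∨' β → α ∷ Γ ⊢ γ → β ∷ Γ ⊢ γ → Γ ⊢ γ
  ∨-elim {α = α} {β} {γ} d e f =
    ⇒-elim (⇒-elim (⇒-elim (ax (ax8 α β γ)) (⇒-intro e)) (⇒-intro f)) d

  ∘-explosion : ∀ {Γ α} β → Γ ⊢ ∘ α → Γ ⊢ inconsistent α → Γ ⊢ β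
  ∘-explosion {α = α} β c d =
    ⇒-elim (⇒-elim (⇒-elim (ax (ax11 α β)) c) (∧-elimˡ d)) (∧-elimʳ d)

∘-or-inconsistent : ∀ L α → ⊢[ L ] ∘ α ∨' inconsistent α
∘-or-inconsistent Cbr α = axiom (ax12-Cbr α)
∘-or-inconsistent Cie α =
  closed (∨-elim (ax (ax10 (∘ α))) (∨-introˡ var₀) (∨-introʳ (⇒-elim (ax (ax12-Cie α)) var₀)))
  where open Derivation Cie

module _ {L : Logic} where
  open Derivation L

  ⇒-trans : ∀ {α β γ} → ⊢[ L ] α ⇒ β → ⊢[ L ] β ⇒ γ → ⊢[ L ] α ⇒ γ
  ⇒-trans d e = closed (⇒-intro (⇒-elim (theorem e) (⇒-elim (theorem d) var₀)))

  ∧-mono : ∀ {α α′ β β′} → ⊢[ L ] α ⇒ α′ → ⊢[ L ] β ⇒ β′ → ⊢[ L ] α ∧' β ⇒ α′ ∧' β′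
  ∧-mono d e = closed (⇒-intro (∧-intro (⇒-elim (theorem d) (∧-elimˡ var₀))
                                        (⇒-elim (theorem e) (∧-elimʳ var₀))))

  ∧-swap : ∀ {α β} → ⊢[ L ] α ∧' β ⇒ β ∧' α
  ∧-swap = closed (⇒-intro (∧-intro (∧-elimʳ var₀) (∧-elimˡ var₀)))

  ⇔-intro : ∀ {α β} → ⊢[ L ] α ⇒ β → ⊢[ L ] β ⇒ α → α ≡[ L ] β
  ⇔-intro d e = closed (∧-intro (theorem d) (theorem e))

  ⇔-to : ∀ {α β} → α ≡[ L ] β → ⊢[ L ] α ⇒ β
  ⇔-to d = closed (∧-elimˡ (theorem d))

  ⇔-from : ∀ {α β} → α ≡[ L ] β → ⊢[ L ] β ⇒ α
  ⇔-from d = closed (∧-elimʳ (theorem d))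

  ⇔-refl : ∀ {α} → α ≡[ L ] α
  ⇔-refl {α} = ⇔-intro (closed (⇒-refl α)) (closed (⇒-refl α))

  ⇔-trans : ∀ {α β γ} → α ≡[ L ] β → β ≡[ L ] γ → α ≡[ L ] γ
  ⇔-trans d e = ⇔-intro (⇒-trans (⇔-to d) (⇔-to e)) (⇒-trans (⇔-from e) (⇔-from d))

  ∧-cong : ∀ {α α′ β β′} → α ≡[ L ] α′ → β ≡[ L ] β′ → α ∧' β ≡[ L ] α′ ∧' β′
  ∧-cong d e = ⇔-intro (∧-mono (⇔-to d) (⇔-to e)) (∧-mono (⇔-from d) (⇔-from e))

  ∧-comm : ∀ {α β} → α ∧' β ≡[ L ] β ∧' α
  ∧-comm = ⇔-intro ∧-swap ∧-swap

  ¬¬-equiv : ∀ {α} → α ≡[ L ] ¬' ¬' α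
  ¬¬-equiv {α} = ⇔-intro (axiom (ax13 α)) (axiom (ax14 α))

  inconsistent≡inconsistent-¬ : ∀ {α} → inconsistent α ≡[ L ] inconsistent (¬' α)
  inconsistent≡inconsistent-¬ = ⇔-trans ∧-comm (∧-cong ⇔-refl ¬¬-equiv)

  ∘-antitone : ∀ {α β} → ⊢[ L ] inconsistent β ⇒ inconsistent α → ⊢[ L ] ∘ α ⇒ ∘ β
  ∘-antitone {α} {β} d =
    closed (⇒-intro (∨-elim (theorem (∘-or-inconsistent L β)) var₀
                            (∘-explosion (∘ β) var₁ (⇒-elim (theorem d) var₀))))

  ∘-resp-inconsistent : ∀ {α β} → inconsistent α ≡[ L ] inconsistent β → ∘ α ≡[ L ] ∘ β
  ∘-resp-inconsistent d = ⇔-intro (∘-antitone (⇔-from d)) (∘-antitone (⇔-to d))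

proposition3p3 : (L : Logic) →
    ((α : Formula) → ∘ α ≡[ L ] ∘ (¬' α)) ×
    ((α β : Formula) → α ≡[ L ] β → ¬' α ≡[ L ] ¬' β → ∘ α ≡[ L ] ∘ β)
proposition3p3 L =
  (λ _ → ∘-resp-inconsistent inconsistent≡inconsistent-¬) ,
  (λ _ _ α≡β ¬α≡¬β → ∘-resp-inconsistent (∧-cong α≡β ¬α≡¬β))
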